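{- For nonnegative integers $m,n,r$ and any number $\alpha\neq 0$, \begin{align*} &\sum_{a=0}^{m-r-2}\sum_{b=0}^{n-r-2}\binom{(1+\alpha)m-a+b-1}{m-r-2-a}\binom{(1+\alpha^{ -1})n+a-b-1}{n-r-2-b}\\ &\quad+\sum_{a=0}^{m+r}\sum_{b=0}^{n+r}\binom{(1+\alpha)m-a+b-1}{m+r-a}\binom{(1+\alpha^{ -1})n+a-b-1}{n+r-b}\\ &=\frac{2mn}{(1+\alpha)(m+\alpha^{ -1}n)}\binom{(1+\alpha)m}{m}\binom{(1+\alpha^{ -1})n}{n} +\sum_{k=-r}^{r}(r-|k|+1)\binom{(1+\alpha)m}{m-k}\binom{(1+\alpha^{ -1})n}{n-k}. \end{align*}
   Context: For an arbitrary (complex) number $z$ and an integer $k$, the binomial coefficient is $\binom{z}{k}=\frac{z(z-1)\cdots(z-k+1)}{k!}$ for $k\ge 0$ and $\binom{z}{k}=0$ for $k<0$. A sum whose upper limit is smaller than its lower limit is empty and equals $0$. -}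

module Defs where

open import Level using (Level; suc; _⊔_)
open import Algebra.Bundles using (CommutativeRing)
open import Data.Nat as ℕ using (ℕ; zero; NonZero; _!)
open import Data.Nat.Properties using (_!≢0)
open import Data.Integer as ℤ using (ℤ; +_; -[1+_]; ∣_∣)
open import Relation.Nullary using (¬_)

ringFromℕ : {c ℓ : Level} (R : CommutativeRing c ℓ) → ℕ → CommutativeRing.Carrier R
ringFromℕ R zero      = CommutativeRing.0# R
ringFromℕ R (ℕ.suc n) = CommutativeRing._+_ R (CommutativeRing.1# R) (ringFromℕ R n)

record CharZeroField (c ℓ : Level) : Set (suc (c ⊔ ℓ)) where
  field
    commutativeRing : CommutativeRing c ℓ
  open CommutativeRing commutativeRing public
  field
    0≉1       : ¬ (0# ≈ 1#)
    inv       : (x : Carrier) → ¬ (x ≈ 0#) → Carrier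
    inv-law   : (x : Carrier) (p : ¬ (x ≈ 0#)) → (x * inv x p) ≈ 1#
    charZero  : (n : ℕ) → .{{_ : NonZero n}} → ¬ (ringFromℕ commutativeRing n ≈ 0#)

  fromℕ : ℕ → Carrier
  fromℕ = ringFromℕ commutativeRing

module FieldOps {c ℓ : Level} (F : CharZeroField c ℓ) where
  open CharZeroField F

  fromℤ : ℤ → Carrier
  fromℤ (+ n)     = fromℕ n
  fromℤ -[1+ n ]  = - fromℕ (ℕ.suc n)

  falling : Carrier → ℕ → Carrier
  falling z zero      = 1#
  falling z (ℕ.suc k) = falling z k * (z - fromℕ k)

  binom : Carrier → ℤ → Carrier
  binom z (+ k)     = falling z k * inv (fromℕ (k !)) (charZero (k !) {{k !≢0}})
  binom z -[1+ k ]  = 0#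

  sumN : ℕ → (ℕ → Carrier) → Carrier
  sumN zero      f = 0#
  sumN (ℕ.suc n) f = sumN n f + f n

  -- Σ_{k=lo}^{hi} f k  (empty, i.e. 0, when hi < lo)
  sumFromTo : ℤ → ℤ → (ℤ → Carrier) → Carrier
  sumFromTo lo hi f = sumN ∣ (hi ℤ.- lo ℤ.+ ℤ.1ℤ) ℤ.⊔ ℤ.0ℤ ∣ (λ i → f (lo ℤ.+ + i))

{-# OPTIONS --safe #-}
module Submission where

open import Defs
open import Level using (Level)
open import Data.Nat as ℕ using (ℕ; zero; suc; _!)
import Data.Nat.Properties as ℕP
open import Data.Integer as ℤ using (ℤ; +_; -[1+_]; _⊖_; ∣_∣)
import Data.Integer.Properties as ℤP
import Data.Integer.Tactic.RingSolver as ℤ-Solver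
import Data.Nat.Tactic.RingSolver as ℕ-Solver
open import Data.Product using (_,_)
open import Data.Sign as Sign using ()
open import Data.Sum using (inj₁; inj₂)
open import Data.Maybe using (Maybe; just; nothing)
open import Relation.Nullary using (¬_; yes; no)
open import Relation.Binary.PropositionalEquality as ≡ using (_≡_)
open import Algebra.Solver.Ring.AlmostCommutativeRing
  using (fromCommutativeRing; _-Raw-AlmostCommutative⟶_)
import Algebra.Solver.Ring as RingSolver
import Algebra.Properties.Ring as RingProperties
import Algebra.Properties.Semiring.Mult as SemiringMult

-- Put x = (1 + α) m and y = (1 + α⁻¹) n; then x + y = D and (x − m)(y − n) = m n.
-- Two shifted Vandermonde convolutions turn the double sum with upper indices p, q into
-- Σ_{j ≥ 0} (j + 1) C(x, p − j) C(y, q − j).  Writing u(k) = C(x, m − k) C(y, n − k),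
-- the left-hand side becomes Σ_k w(k) u(k) with w(k) = (k + r + 1)₊ + (k − r − 1)₊
-- = (r + 1 − |k|)₊ + 2 k₊.  Finally (x − m + k)(y − n + k) u(k) telescopes, because
-- (x + y) k u(k) is its first difference, so (x + y) Σ_k k u(k) = m n u(0).

-[1+k]-j<0 : ∀ k j → -[1+ k ] ℤ.- + j ℤ.< ℤ.0ℤ
-[1+k]-j<0 k j = ℤP.≤-<-trans (ℤP.i-j≤i -[1+ k ] (+ j)) ℤ.-<+

i<j⇒i-j<0 : ∀ {i j} → i ℤ.< j → i ℤ.- j ℤ.< ℤ.0ℤ
i<j⇒i-j<0 {i} {j} i<j = ≡.subst (i ℤ.- j ℤ.<_) (ℤP.+-inverseʳ j) (ℤP.+-monoˡ-< (ℤ.- j) i<j)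

i-j-1≡i-1-j : ∀ i j → (i ℤ.- j) ℤ.- ℤ.1ℤ ≡ (i ℤ.- ℤ.1ℤ) ℤ.- j
i-j-1≡i-1-j = ℤ-Solver.solve-∀

i-[1+j]≡i-1-j : ∀ i j → i ℤ.- (ℤ.1ℤ ℤ.+ j) ≡ (i ℤ.- ℤ.1ℤ) ℤ.- j
i-[1+j]≡i-1-j = ℤ-Solver.solve-∀

r-d+1≡[1+r]∸d : ∀ r d → d ℕ.≤ suc r → + r ℤ.- + d ℤ.+ ℤ.1ℤ ≡ + (suc r ℕ.∸ d)
r-d+1≡[1+r]∸d r d d≤1+r =
  ≡.trans (shuffle (+ r) (+ d)) (≡.trans (ℤP.m-n≡m⊖n (suc r) d) (ℤP.⊖-≥ d≤1+r))
  where
  shuffle : ∀ r d → r ℤ.- d ℤ.+ ℤ.1ℤ ≡ (ℤ.1ℤ ℤ.+ r) ℤ.- d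
  shuffle = ℤ-Solver.solve-∀

∣m⊖n∣≡∣m-n∣ : ∀ m n → ∣ m ⊖ n ∣ ≡ ℕ.∣ m - n ∣
∣m⊖n∣≡∣m-n∣ m n with ℕP.≤-total m n
... | inj₁ m≤n = ≡.trans (ℤP.∣⊖∣-≤ m≤n) (≡.sym (ℕP.m≤n⇒∣m-n∣≡n∸m m≤n))
... | inj₂ n≤m = ≡.trans (≡.cong ∣_∣ (ℤP.⊖-≥ n≤m)) (≡.sym (ℕP.m≤n⇒∣n-m∣≡n∸m n≤m))

∣m-n∣≤n : ∀ {m n} → m ℕ.≤ n ℕ.+ n → ℕ.∣ m - n ∣ ℕ.≤ n
∣m-n∣≤n {m} {n} m≤2n with ℕP.∣m-n∣≡[m∸n]∨[n∸m] m n
... | inj₁ eq = ≡.subst (ℕ._≤ n) (≡.sym eq) (ℕP.m≤n+o⇒m∸n≤o m n m≤2n)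
... | inj₂ eq = ≡.subst (ℕ._≤ n) (≡.sym eq) (ℕP.m∸n≤m n m)

m∸n+n≡n∸m+m : ∀ m n → m ℕ.∸ n ℕ.+ n ≡ n ℕ.∸ m ℕ.+ m
m∸n+n≡n∸m+m zero    zero    = ≡.refl
m∸n+n≡n∸m+m zero    (suc n) = ≡.sym (ℕP.+-identityʳ (suc n))
m∸n+n≡n∸m+m (suc m) zero    = ℕP.+-identityʳ (suc m)
m∸n+n≡n∸m+m (suc m) (suc n) =
  ≡.trans (ℕP.+-suc (m ℕ.∸ n) n) (≡.trans (≡.cong suc (m∸n+n≡n∸m+m m n)) (≡.sym (ℕP.+-suc (n ℕ.∸ m) m)))

weight-identity : ∀ r i → i ℕ.∸ suc (r ℕ.+ r) ℕ.+ suc i ≡ 2 ℕ.* (i ℕ.∸ r) ℕ.+ (suc r ℕ.∸ ℕ.∣ i - r ∣)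
weight-identity r i with ℕP.≤-total i r
... | inj₁ i≤r with ℕP.m≤n⇒∃[o]m+o≡n i≤r
...   | t , ≡.refl
  rewrite ℕP.m≤n⇒m∸n≡0 (ℕP.≤-trans (ℕP.m≤m+n i t) (ℕP.m≤n+m (i ℕ.+ t) (suc (i ℕ.+ t))))
        | ℕP.m≤n⇒m∸n≡0 (ℕP.m≤m+n i t) | ℕP.∣m-m+n∣≡n i t | ℕP.m+n∸n≡m (suc i) t = ≡.refl
weight-identity r i | inj₂ r≤i with ℕP.m≤n⇒∃[o]m+o≡n r≤i
...   | t , ≡.refl
  rewrite ℕP.m+n∸m≡n r t | ≡.trans (ℕP.∣-∣-comm (r ℕ.+ t) r) (ℕP.∣m-m+n∣≡n r t)
        | ≡.trans (≡.cong (r ℕ.+ t ℕ.∸_) (≡.sym (ℕP.+-suc r r))) (ℕP.[m+n]∸[m+o]≡n∸o r t (suc r)) = begin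
  t ℕ.∸ suc r ℕ.+ (suc r ℕ.+ t)   ≡⟨ ≡.sym (ℕP.+-assoc (t ℕ.∸ suc r) (suc r) t) ⟩
  t ℕ.∸ suc r ℕ.+ suc r ℕ.+ t     ≡⟨ ≡.cong (ℕ._+ t) (m∸n+n≡n∸m+m t (suc r)) ⟩
  suc r ℕ.∸ t ℕ.+ t ℕ.+ t         ≡⟨ regroup (suc r ℕ.∸ t) t ⟩
  2 ℕ.* t ℕ.+ (suc r ℕ.∸ t)       ∎
  where
  open ≡.≡-Reasoning
  regroup : ∀ a t → a ℕ.+ t ℕ.+ t ≡ 2 ℕ.* t ℕ.+ a
  regroup = ℕ-Solver.solve-∀

[1+r]∸∣i-r∣≡0 : ∀ r i → suc (r ℕ.+ r) ℕ.≤ i → suc r ℕ.∸ ℕ.∣ i - r ∣ ≡ 0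
[1+r]∸∣i-r∣≡0 r i 1+2r≤i = ℕP.m≤n⇒m∸n≡0
  (≡.subst (suc r ℕ.≤_) (≡.sym (ℕP.m≤n⇒∣n-m∣≡n∸m r≤i))
    (≡.subst (ℕ._≤ i ℕ.∸ r) (ℕP.m+n∸n≡m (suc r) r) (ℕP.∸-monoˡ-≤ r 1+2r≤i)))
  where
  r≤i : r ℕ.≤ i
  r≤i = ℕP.≤-trans (ℕP.m≤m+n r r) (ℕP.≤-trans (ℕP.n≤1+n _) 1+2r≤i)

module _ {c ℓ : Level} (F : CharZeroField c ℓ) where
  open CharZeroField F hiding (zero)
  open FieldOps F
  open RingProperties ring using (-‿distribˡ-*; -‿distribʳ-*; -‿involutive; -0#≈0#; -‿+-comm)
  open SemiringMult semiring using (_×_; ×-homo-+; ×1-homo-*)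
  open import Relation.Binary.Reasoning.Setoid setoid

  fromℕ≈×1# : ∀ n → fromℕ n ≈ n × 1#
  fromℕ≈×1# zero    = refl
  fromℕ≈×1# (suc n) = +-congˡ (fromℕ≈×1# n)

  fromℕ-+ : ∀ m n → fromℕ (m ℕ.+ n) ≈ fromℕ m + fromℕ n
  fromℕ-+ m n = trans (fromℕ≈×1# (m ℕ.+ n))
    (trans (×-homo-+ 1# m n) (sym (+-cong (fromℕ≈×1# m) (fromℕ≈×1# n))))

  fromℕ-* : ∀ m n → fromℕ (m ℕ.* n) ≈ fromℕ m * fromℕ n
  fromℕ-* m n = trans (fromℕ≈×1# (m ℕ.* n))
    (trans (×1-homo-* m n) (sym (*-cong (fromℕ≈×1# m) (fromℕ≈×1# n))))

  fromℕ-∸ : ∀ {m n} → n ℕ.≤ m → fromℕ (m ℕ.∸ n) ≈ fromℕ m - fromℕ n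
  fromℕ-∸ {m} {n} n≤m = begin
    fromℕ (m ℕ.∸ n)                       ≈⟨ sym (+-identityʳ _) ⟩
    fromℕ (m ℕ.∸ n) + 0#                  ≈⟨ +-congˡ (sym (-‿inverseʳ _)) ⟩
    fromℕ (m ℕ.∸ n) + (fromℕ n - fromℕ n) ≈⟨ sym (+-assoc _ _ _) ⟩
    fromℕ (m ℕ.∸ n) + fromℕ n - fromℕ n   ≈⟨ +-congʳ (sym (fromℕ-+ (m ℕ.∸ n) n)) ⟩
    fromℕ (m ℕ.∸ n ℕ.+ n) - fromℕ n       ≈⟨ reflexive (≡.cong (λ t → fromℕ t - fromℕ n) (ℕP.m∸n+n≡m n≤m)) ⟩
    fromℕ m - fromℕ n                     ∎

  fromℤ-neg-+ : ∀ n → fromℤ (ℤ.- + n) ≈ - fromℕ n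
  fromℤ-neg-+ zero    = sym -0#≈0#
  fromℤ-neg-+ (suc n) = refl

  fromℤ-⊖ : ∀ m n → fromℤ (m ⊖ n) ≈ fromℕ m - fromℕ n
  fromℤ-⊖ m n with ℕP.≤-total n m
  ... | inj₁ n≤m = trans (reflexive (≡.cong fromℤ (ℤP.⊖-≥ n≤m))) (fromℕ-∸ n≤m)
  ... | inj₂ m≤n = begin
    fromℤ (m ⊖ n)               ≈⟨ reflexive (≡.cong fromℤ (ℤP.⊖-≤ m≤n)) ⟩
    fromℤ (ℤ.- + (n ℕ.∸ m))     ≈⟨ fromℤ-neg-+ (n ℕ.∸ m) ⟩
    - fromℕ (n ℕ.∸ m)           ≈⟨ -‿cong (fromℕ-∸ m≤n) ⟩
    - (fromℕ n - fromℕ m)       ≈⟨ sym (-‿+-comm _ _) ⟩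
    - fromℕ n + - - fromℕ m     ≈⟨ +-comm _ _ ⟩
    - - fromℕ m - fromℕ n       ≈⟨ +-congʳ (-‿involutive _) ⟩
    fromℕ m - fromℕ n           ∎

  fromℤ-+ : ∀ i j → fromℤ (i ℤ.+ j) ≈ fromℤ i + fromℤ j
  fromℤ-+ (+ m)    (+ n)    = fromℕ-+ m n
  fromℤ-+ (+ m)    -[1+ n ] = fromℤ-⊖ m (suc n)
  fromℤ-+ -[1+ m ] (+ n)    = trans (fromℤ-⊖ n (suc m)) (+-comm _ _)
  fromℤ-+ -[1+ m ] -[1+ n ] = begin
    - fromℕ (suc (suc (m ℕ.+ n)))      ≈⟨ -‿cong (reflexive (≡.cong (λ k → fromℕ (suc k)) (≡.sym (ℕP.+-suc m n)))) ⟩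
    - fromℕ (suc m ℕ.+ suc n)          ≈⟨ -‿cong (fromℕ-+ (suc m) (suc n)) ⟩
    - (fromℕ (suc m) + fromℕ (suc n))  ≈⟨ sym (-‿+-comm _ _) ⟩
    - fromℕ (suc m) + - fromℕ (suc n)  ∎

  fromℤ-minus : ∀ m n → fromℤ (+ m ℤ.- + n) ≈ fromℕ m - fromℕ n
  fromℤ-minus m n = trans (reflexive (≡.cong fromℤ (ℤP.m-n≡m⊖n m n))) (fromℤ-⊖ m n)

  fromℤ-neg : ∀ i → fromℤ (ℤ.- i) ≈ - fromℤ i
  fromℤ-neg (+ n)    = fromℤ-neg-+ n
  fromℤ-neg -[1+ n ] = sym (-‿involutive _)

  fromℤ-+◃ : ∀ n → fromℤ (Sign.+ ℤ.◃ n) ≈ fromℕ n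
  fromℤ-+◃ n = reflexive (≡.cong fromℤ (ℤP.+◃n≡+n n))

  fromℤ--◃ : ∀ n → fromℤ (Sign.- ℤ.◃ n) ≈ - fromℕ n
  fromℤ--◃ n = trans (reflexive (≡.cong fromℤ (ℤP.-◃n≡-n n))) (fromℤ-neg-+ n)

  fromℤ-* : ∀ i j → fromℤ (i ℤ.* j) ≈ fromℤ i * fromℤ j
  fromℤ-* (+ m)    (+ n)    = trans (fromℤ-+◃ (m ℕ.* n)) (fromℕ-* m n)
  fromℤ-* (+ m)    -[1+ n ] = trans (fromℤ--◃ (m ℕ.* suc n))
    (trans (-‿cong (fromℕ-* m (suc n))) (-‿distribʳ-* _ _))
  fromℤ-* -[1+ m ] (+ n)    = trans (fromℤ--◃ (suc m ℕ.* n))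
    (trans (-‿cong (fromℕ-* (suc m) n)) (-‿distribˡ-* _ _))
  fromℤ-* -[1+ m ] -[1+ n ] = begin
    fromℤ (Sign.+ ℤ.◃ (suc m ℕ.* suc n))  ≈⟨ fromℤ-+◃ (suc m ℕ.* suc n) ⟩
    fromℕ (suc m ℕ.* suc n)               ≈⟨ fromℕ-* (suc m) (suc n) ⟩
    fromℕ (suc m) * fromℕ (suc n)         ≈⟨ sym (-‿involutive _) ⟩
    - - (fromℕ (suc m) * fromℕ (suc n))   ≈⟨ -‿cong (-‿distribˡ-* _ _) ⟩
    - (- fromℕ (suc m) * fromℕ (suc n))   ≈⟨ -‿distribʳ-* _ _ ⟩
    - fromℕ (suc m) * - fromℕ (suc n)     ∎

  -- The solver interprets a constant `con i` as `coefficient i`; sending 0 and 1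
  -- to `0#` and `1#` on the nose lets solved equations mention `0#` and `1#`.
  coefficient : ℤ → Carrier
  coefficient (+ 0) = 0#
  coefficient (+ 1) = 1#
  coefficient i     = fromℤ i

  coefficient≈fromℤ : ∀ i → coefficient i ≈ fromℤ i
  coefficient≈fromℤ (+ 0)           = refl
  coefficient≈fromℤ (+ 1)           = sym (+-identityʳ _)
  coefficient≈fromℤ (+ suc (suc n)) = refl
  coefficient≈fromℤ -[1+ n ]        = refl

  coefficient-homo : ℤ.+-*-rawRing -Raw-AlmostCommutative⟶ fromCommutativeRing commutativeRing
  coefficient-homo = record
    { ⟦_⟧    = coefficient
    ; +-homo = λ i j → trans (coefficient≈fromℤ (i ℤ.+ j))
                 (trans (fromℤ-+ i j) (sym (+-cong (coefficient≈fromℤ i) (coefficient≈fromℤ j))))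
    ; *-homo = λ i j → trans (coefficient≈fromℤ (i ℤ.* j))
                 (trans (fromℤ-* i j) (sym (*-cong (coefficient≈fromℤ i) (coefficient≈fromℤ j))))
    ; -‿homo = λ i → trans (coefficient≈fromℤ (ℤ.- i))
                 (trans (fromℤ-neg i) (sym (-‿cong (coefficient≈fromℤ i))))
    ; 0-homo = refl
    ; 1-homo = refl
    }

  coefficient-≟ : ∀ i j → Maybe (coefficient i ≈ coefficient j)
  coefficient-≟ i j with i ℤ.≟ j
  ... | yes ≡.refl = just refl
  ... | no _       = nothing

  open RingSolver ℤ.+-*-rawRing (fromCommutativeRing commutativeRing) coefficient-homo coefficient-≟
    using (solve; _:+_; _:*_; _:-_; :-_; con; _:=_)

  inv-unique : ∀ {x y} (x≉0 : ¬ (x ≈ 0#)) → x * y ≈ 1# → y ≈ inv x x≉0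
  inv-unique {x} {y} x≉0 xy≈1 = begin
    y                  ≈⟨ sym (*-identityʳ _) ⟩
    y * 1#             ≈⟨ *-congˡ (sym (inv-law x x≉0)) ⟩
    y * (x * x⁻¹)      ≈⟨ solve 3 (λ x y x⁻¹ → y :* (x :* x⁻¹) := (x :* y) :* x⁻¹) refl x y x⁻¹ ⟩
    (x * y) * x⁻¹      ≈⟨ *-congʳ xy≈1 ⟩
    1# * x⁻¹           ≈⟨ *-identityˡ _ ⟩
    x⁻¹                ∎
    where
    x⁻¹ : Carrier
    x⁻¹ = inv x x≉0

  invFact : ℕ → Carrier
  invFact k = inv (fromℕ (k !)) (charZero (k !) {{k ℕP.!≢0}})

  fromℕ-suc-*-invFact : ∀ k → fromℕ (suc k) * invFact (suc k) ≈ invFact k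
  fromℕ-suc-*-invFact k = inv-unique _ (begin
    fromℕ (k !) * (fromℕ (suc k) * invFact (suc k))  ≈⟨ sym (*-assoc _ _ _) ⟩
    fromℕ (k !) * fromℕ (suc k) * invFact (suc k)    ≈⟨ *-congʳ (*-comm _ _) ⟩
    fromℕ (suc k) * fromℕ (k !) * invFact (suc k)    ≈⟨ *-congʳ (sym (fromℕ-* (suc k) (k !))) ⟩
    fromℕ (suc k !) * invFact (suc k)                ≈⟨ inv-law _ _ ⟩
    1#                                               ∎)

  falling-cong : ∀ {z w} k → z ≈ w → falling z k ≈ falling w k
  falling-cong zero    z≈w = refl
  falling-cong (suc k) z≈w = *-cong (falling-cong k z≈w) (+-congʳ z≈w)

  falling-pascal : ∀ z k → falling (z + 1#) (suc k) ≈ falling z (suc k) + fromℕ (suc k) * falling z k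
  falling-pascal z zero    =
    solve 1 (λ z → con (+ 1) :* (z :+ con (+ 1) :- con (+ 0))
                := con (+ 1) :* (z :- con (+ 0)) :+ (con (+ 1) :+ con (+ 0)) :* con (+ 1)) refl z
  falling-pascal z (suc k) = begin
    falling (z + 1#) (suc k) * (z + 1# - fromℕ (suc k))
      ≈⟨ *-congʳ (falling-pascal z k) ⟩
    (falling z k * (z - fromℕ k) + fromℕ (suc k) * falling z k) * (z + 1# - fromℕ (suc k))
      ≈⟨ solve 3 (λ f z k → (f :* (z :- k) :+ (con (+ 1) :+ k) :* f) :* (z :+ con (+ 1) :- (con (+ 1) :+ k))
                         := f :* (z :- k) :* (z :- (con (+ 1) :+ k)) :+ (con (+ 1) :+ (con (+ 1) :+ k)) :* (f :* (z :- k)))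
                refl (falling z k) z (fromℕ k) ⟩
    falling z (suc (suc k)) + fromℕ (suc (suc k)) * falling z (suc k) ∎

  binom-cong : ∀ {z w} k → z ≈ w → binom z k ≈ binom w k
  binom-cong (+ k)    z≈w = *-congʳ (falling-cong k z≈w)
  binom-cong -[1+ k ] z≈w = refl

  binom-negative : ∀ z {k} → k ℤ.< ℤ.0ℤ → binom z k ≈ 0#
  binom-negative z { -[1+ k ]} _             = refl
  binom-negative z {+ k}      (ℤ.+<+ ())

  binom-pascal : ∀ z k → binom (z + 1#) k ≈ binom z k + binom z (k ℤ.- ℤ.1ℤ)
  binom-pascal z (+ zero)  = sym (+-identityʳ _)
  binom-pascal z (+ suc k) = begin
    falling (z + 1#) (suc k) * invFact (suc k)
      ≈⟨ *-congʳ (falling-pascal z k) ⟩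
    (falling z (suc k) + fromℕ (suc k) * falling z k) * invFact (suc k)
      ≈⟨ distribʳ _ _ _ ⟩
    binom z (+ suc k) + fromℕ (suc k) * falling z k * invFact (suc k)
      ≈⟨ +-congˡ (solve 3 (λ a f i → a :* f :* i := f :* (a :* i)) refl (fromℕ (suc k)) (falling z k) (invFact (suc k))) ⟩
    binom z (+ suc k) + falling z k * (fromℕ (suc k) * invFact (suc k))
      ≈⟨ +-congˡ (*-congˡ (fromℕ-suc-*-invFact k)) ⟩
    binom z (+ suc k) + binom z (+ k) ∎
  binom-pascal z -[1+ k ]  = sym (+-identityʳ _)

  binom-absorption : ∀ z k → fromℤ k * binom z k ≈ (z - fromℤ k + 1#) * binom z (k ℤ.- ℤ.1ℤ)
  binom-absorption z (+ zero)  = trans (zeroˡ _) (sym (zeroʳ _))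
  binom-absorption z (+ suc k) = begin
    fromℕ (suc k) * (falling z k * (z - fromℕ k) * invFact (suc k))
      ≈⟨ solve 4 (λ a f d i → a :* (f :* d :* i) := d :* (f :* (a :* i)))
                refl (fromℕ (suc k)) (falling z k) (z - fromℕ k) (invFact (suc k)) ⟩
    (z - fromℕ k) * (falling z k * (fromℕ (suc k) * invFact (suc k)))
      ≈⟨ *-cong (solve 2 (λ z k → z :- k := z :- (con (+ 1) :+ k) :+ con (+ 1)) refl z (fromℕ k))
                (*-congˡ (fromℕ-suc-*-invFact k)) ⟩
    (z - fromℕ (suc k) + 1#) * binom z (+ k) ∎
  binom-absorption z -[1+ k ]  = trans (zeroʳ _) (sym (zeroʳ _))

  sumN-cong< : ∀ n {f g : ℕ → Carrier} → (∀ i → i ℕ.< n → f i ≈ g i) → sumN n f ≈ sumN n g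
  sumN-cong< zero    f≈g = refl
  sumN-cong< (suc n) f≈g = +-cong (sumN-cong< n (λ i i<n → f≈g i (ℕP.m<n⇒m<1+n i<n))) (f≈g n ℕP.≤-refl)

  sumN-cong : ∀ n {f g : ℕ → Carrier} → (∀ i → f i ≈ g i) → sumN n f ≈ sumN n g
  sumN-cong n f≈g = sumN-cong< n (λ i _ → f≈g i)

  sumN-length : ∀ {m n} (f : ℕ → Carrier) → m ≡ n → sumN m f ≈ sumN n f
  sumN-length f ≡.refl = refl

  sumN-zero : ∀ n (f : ℕ → Carrier) → (∀ i → i ℕ.< n → f i ≈ 0#) → sumN n f ≈ 0#
  sumN-zero zero    f f≈0 = refl
  sumN-zero (suc n) f f≈0 = trans (+-cong (sumN-zero n f (λ i i<n → f≈0 i (ℕP.m<n⇒m<1+n i<n)))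
                                          (f≈0 n ℕP.≤-refl))
                                  (+-identityʳ _)

  sumN-+ : ∀ n (f g : ℕ → Carrier) → sumN n (λ i → f i + g i) ≈ sumN n f + sumN n g
  sumN-+ zero    f g = sym (+-identityʳ _)
  sumN-+ (suc n) f g = trans (+-congʳ (sumN-+ n f g))
    (solve 4 (λ a b c d → a :+ b :+ (c :+ d) := a :+ c :+ (b :+ d)) refl (sumN n f) (sumN n g) (f n) (g n))

  *-distribˡ-sumN : ∀ n a (f : ℕ → Carrier) → a * sumN n f ≈ sumN n (λ i → a * f i)
  *-distribˡ-sumN zero    a f = zeroʳ _
  *-distribˡ-sumN (suc n) a f = trans (distribˡ _ _ _) (+-congʳ (*-distribˡ-sumN n a f))

  sumN-const : ∀ n a → sumN n (λ _ → a) ≈ fromℕ n * a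
  sumN-const zero    a = sym (zeroˡ _)
  sumN-const (suc n) a = trans (+-congʳ (sumN-const n a))
    (solve 2 (λ n a → n :* a :+ a := (con (+ 1) :+ n) :* a) refl (fromℕ n) a)

  sumN-suc : ∀ n (f : ℕ → Carrier) → sumN (suc n) f ≈ f 0 + sumN n (λ i → f (suc i))
  sumN-suc zero    f = trans (+-identityˡ _) (sym (+-identityʳ _))
  sumN-suc (suc n) f = trans (+-congʳ (sumN-suc n f)) (+-assoc _ _ _)

  sumN-+-length : ∀ m n (f : ℕ → Carrier) → sumN (m ℕ.+ n) f ≈ sumN m f + sumN n (λ i → f (m ℕ.+ i))
  sumN-+-length m zero    f = trans (sumN-length f (ℕP.+-identityʳ m)) (sym (+-identityʳ _))
  sumN-+-length m (suc n) f = begin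
    sumN (m ℕ.+ suc n) f                                  ≈⟨ sumN-length f (ℕP.+-suc m n) ⟩
    sumN (m ℕ.+ n) f + f (m ℕ.+ n)                        ≈⟨ +-congʳ (sumN-+-length m n f) ⟩
    sumN m f + sumN n (λ i → f (m ℕ.+ i)) + f (m ℕ.+ n)   ≈⟨ +-assoc _ _ _ ⟩
    sumN m f + sumN (suc n) (λ i → f (m ℕ.+ i))           ∎

  sumN-dropˡ : ∀ m n (f : ℕ → Carrier) → (∀ i → i ℕ.< m → f i ≈ 0#) →
               sumN (m ℕ.+ n) f ≈ sumN n (λ i → f (m ℕ.+ i))
  sumN-dropˡ m n f f≈0 = trans (sumN-+-length m n f) (trans (+-congʳ (sumN-zero m f f≈0)) (+-identityˡ _))

  sumN-extend : ∀ {m n} (f : ℕ → Carrier) → m ℕ.≤ n → (∀ i → m ℕ.≤ i → i ℕ.< n → f i ≈ 0#) →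
                sumN n f ≈ sumN m f
  sumN-extend {m} {n} f m≤n f≈0 = begin
    sumN n f                                        ≈⟨ sumN-length f (≡.sym (ℕP.m+[n∸m]≡n m≤n)) ⟩
    sumN (m ℕ.+ (n ℕ.∸ m)) f                        ≈⟨ sumN-+-length m (n ℕ.∸ m) f ⟩
    sumN m f + sumN (n ℕ.∸ m) (λ i → f (m ℕ.+ i))   ≈⟨ +-congˡ (sumN-zero _ _ tail≈0) ⟩
    sumN m f + 0#                                   ≈⟨ +-identityʳ _ ⟩
    sumN m f                                        ∎
    where
    tail≈0 : ∀ i → i ℕ.< n ℕ.∸ m → f (m ℕ.+ i) ≈ 0#
    tail≈0 i i<n∸m = f≈0 (m ℕ.+ i) (ℕP.m≤m+n m i)
      (≡.subst (m ℕ.+ i ℕ.<_) (ℕP.m+[n∸m]≡n m≤n) (ℕP.+-monoʳ-< m i<n∸m))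

  sumN-swap : ∀ m n (f : ℕ → ℕ → Carrier) →
              sumN m (λ i → sumN n (f i)) ≈ sumN n (λ j → sumN m (λ i → f i j))
  sumN-swap zero    n f = sym (sumN-zero n _ (λ _ _ → refl))
  sumN-swap (suc m) n f = trans (+-congʳ (sumN-swap m n f)) (sym (sumN-+ n _ _))

  sumN-telescope : ∀ n (g : ℕ → Carrier) → sumN n (λ i → g i - g (suc i)) ≈ g 0 - g n
  sumN-telescope zero    g = sym (-‿inverseʳ _)
  sumN-telescope (suc n) g = trans (+-congʳ (sumN-telescope n g))
    (solve 3 (λ a b c → a :- b :+ (b :- c) := a :- c) refl (g 0) (g n) (g (suc n)))

  sumN-antidiagonal : ∀ n (g : ℕ → Carrier) →
    sumN n (λ k → sumN (n ℕ.∸ k) (λ l → g (k ℕ.+ l))) ≈ sumN n (λ j → fromℕ (suc j) * g j)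
  sumN-antidiagonal zero    g = refl
  sumN-antidiagonal (suc n) g = begin
    sumN n (λ k → sumN (suc n ℕ.∸ k) (λ l → g (k ℕ.+ l))) + sumN (suc n ℕ.∸ n) (λ l → g (n ℕ.+ l))
      ≈⟨ +-cong (sumN-cong< n row) last ⟩
    sumN n (λ k → sumN (n ℕ.∸ k) (λ l → g (k ℕ.+ l)) + g n) + g n
      ≈⟨ +-congʳ (trans (sumN-+ n _ _) (+-cong (sumN-antidiagonal n g) (sumN-const n (g n)))) ⟩
    sumN n (λ j → fromℕ (suc j) * g j) + fromℕ n * g n + g n
      ≈⟨ solve 3 (λ s n g → s :+ n :* g :+ g := s :+ (con (+ 1) :+ n) :* g) refl _ (fromℕ n) (g n) ⟩
    sumN n (λ j → fromℕ (suc j) * g j) + fromℕ (suc n) * g n ∎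
    where
    row : ∀ k → k ℕ.< n → sumN (suc n ℕ.∸ k) (λ l → g (k ℕ.+ l)) ≈ sumN (n ℕ.∸ k) (λ l → g (k ℕ.+ l)) + g n
    row k k<n = trans (sumN-length _ (ℕP.+-∸-assoc 1 (ℕP.<⇒≤ k<n)))
      (+-congˡ (reflexive (≡.cong g (ℕP.m+[n∸m]≡n (ℕP.<⇒≤ k<n)))))
    last : sumN (suc n ℕ.∸ n) (λ l → g (n ℕ.+ l)) ≈ g n
    last = trans (sumN-length _ (ℕP.m+n∸n≡m 1 n))
      (trans (+-identityˡ _) (reflexive (≡.cong g (ℕP.+-identityʳ n))))

  sumN-rectangle : ∀ a b n (g : ℕ → Carrier) → a ℕ.≤ n → b ℕ.≤ n →
    (∀ j → a ℕ.≤ j → g j ≈ 0#) → (∀ j → b ℕ.≤ j → g j ≈ 0#) →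
    sumN a (λ k → sumN b (λ l → g (k ℕ.+ l))) ≈ sumN n (λ j → fromℕ (suc j) * g j)
  sumN-rectangle a b n g a≤n b≤n g≈0ᵃ g≈0ᵇ = begin
    sumN a (λ k → sumN b (λ l → g (k ℕ.+ l)))
      ≈⟨ sumN-cong a (λ k → sym (sumN-extend _ b≤n (λ l b≤l _ → g≈0ᵇ (k ℕ.+ l) (ℕP.≤-trans b≤l (ℕP.m≤n+m l k))))) ⟩
    sumN a (λ k → sumN n (λ l → g (k ℕ.+ l)))
      ≈⟨ sym (sumN-extend _ a≤n (λ k a≤k _ → sumN-zero n _ (λ l _ → g≈0ᵃ (k ℕ.+ l) (ℕP.≤-trans a≤k (ℕP.m≤m+n k l))))) ⟩
    sumN n (λ k → sumN n (λ l → g (k ℕ.+ l)))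
      ≈⟨ sumN-cong< n (λ k k<n → sumN-extend _ (ℕP.m∸n≤m n k) (λ l n∸k≤l _ → g≈0ᵃ (k ℕ.+ l)
           (ℕP.≤-trans a≤n (≡.subst (ℕ._≤ k ℕ.+ l) (ℕP.m+[n∸m]≡n (ℕP.<⇒≤ k<n)) (ℕP.+-monoʳ-≤ k n∸k≤l))))) ⟩
    sumN n (λ k → sumN (n ℕ.∸ k) (λ l → g (k ℕ.+ l)))
      ≈⟨ sumN-antidiagonal n g ⟩
    sumN n (λ j → fromℕ (suc j) * g j) ∎

  binom-index : ∀ z {k l} → k ≡ l → binom z k ≈ binom z l
  binom-index z k≡l = reflexive (≡.cong (binom z) k≡l)

  diagonalSum : ℕ → Carrier → Carrier → ℤ → ℤ → Carrier
  diagonalSum N z w p q = sumN N (λ k → binom z (p ℤ.- + k) * binom w (q ℤ.- + k))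

  diagonalSum-pascalˡ : ∀ N z w p q →
    diagonalSum N (z + 1#) w p q ≈ diagonalSum N z w p q + diagonalSum N z w (p ℤ.- ℤ.1ℤ) q
  diagonalSum-pascalˡ N z w p q = trans (sumN-cong N (λ k → trans
      (*-congʳ (trans (binom-pascal z (p ℤ.- + k)) (+-congˡ (binom-index z (i-j-1≡i-1-j p (+ k))))))
      (distribʳ _ _ _)))
    (sumN-+ N _ _)

  diagonalSum-pascalʳ : ∀ N z w p q →
    diagonalSum N z (w + 1#) p q ≈ diagonalSum N z w p q + diagonalSum N z w p (q ℤ.- ℤ.1ℤ)
  diagonalSum-pascalʳ N z w p q = trans (sumN-cong N (λ k → trans
      (*-congˡ (trans (binom-pascal w (q ℤ.- + k)) (+-congˡ (binom-index w (i-j-1≡i-1-j q (+ k))))))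
      (distribˡ _ _ _)))
    (sumN-+ N _ _)

  diagonalSum-suc : ∀ N z w p q →
    diagonalSum (suc N) z w p q ≈ binom z p * binom w q + diagonalSum N z w (p ℤ.- ℤ.1ℤ) (q ℤ.- ℤ.1ℤ)
  diagonalSum-suc N z w p q = trans (sumN-suc N _)
    (+-cong (*-cong (binom-index z (ℤP.+-identityʳ p)) (binom-index w (ℤP.+-identityʳ q)))
            (sumN-cong N (λ k → *-cong (binom-index z (i-[1+j]≡i-1-j p (+ k)))
                                       (binom-index w (i-[1+j]≡i-1-j q (+ k))))))

  diagonalSum-last : ∀ N z w p q → q ℤ.< + N → diagonalSum (suc N) z w p q ≈ diagonalSum N z w p q
  diagonalSum-last N z w p q q<N =
    trans (+-congˡ (trans (*-congˡ (binom-negative w (i<j⇒i-j<0 q<N))) (zeroʳ _))) (+-identityʳ _)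

  binom-convolution : ∀ N z w p q → q ℤ.< + N →
    sumN N (λ b → binom (z + fromℕ b) p * binom (w - fromℕ b - 1#) (q ℤ.- + b))
    ≈ diagonalSum N z w p q
  binom-convolution zero    z w p q _     = refl
  binom-convolution (suc N) z w p q q<1+N = begin
    sumN (suc N) (term z w q)
      ≈⟨ sumN-suc N _ ⟩
    term z w q 0 + sumN N (λ b → term z w q (suc b))
      ≈⟨ +-cong first (sumN-cong N rest) ⟩
    binom z p * binom w′ q + sumN N (term (z + 1#) w′ (q ℤ.- ℤ.1ℤ))
      ≈⟨ +-congˡ (binom-convolution N (z + 1#) w′ p (q ℤ.- ℤ.1ℤ) q-1<N) ⟩
    binom z p * binom w′ q + diagonalSum N (z + 1#) w′ p (q ℤ.- ℤ.1ℤ)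
      ≈⟨ +-congˡ (diagonalSum-pascalˡ N z w′ p (q ℤ.- ℤ.1ℤ)) ⟩
    binom z p * binom w′ q + (diagonalSum N z w′ p (q ℤ.- ℤ.1ℤ) + diagonalSum N z w′ (p ℤ.- ℤ.1ℤ) (q ℤ.- ℤ.1ℤ))
      ≈⟨ solve 3 (λ a b c → a :+ (b :+ c) := a :+ c :+ b) refl _ _ _ ⟩
    binom z p * binom w′ q + diagonalSum N z w′ (p ℤ.- ℤ.1ℤ) (q ℤ.- ℤ.1ℤ) + diagonalSum N z w′ p (q ℤ.- ℤ.1ℤ)
      ≈⟨ +-cong (sym (diagonalSum-suc N z w′ p q)) (sym (diagonalSum-last N z w′ p (q ℤ.- ℤ.1ℤ) q-1<N)) ⟩
    diagonalSum (suc N) z w′ p q + diagonalSum (suc N) z w′ p (q ℤ.- ℤ.1ℤ)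
      ≈⟨ sym (diagonalSum-pascalʳ (suc N) z w′ p q) ⟩
    diagonalSum (suc N) z (w′ + 1#) p q
      ≈⟨ sumN-cong (suc N) (λ k → *-congˡ (binom-cong (q ℤ.- + k) w′+1≈w)) ⟩
    diagonalSum (suc N) z w p q ∎
    where
    w′ : Carrier
    w′ = w - 1#
    w′+1≈w : w′ + 1# ≈ w
    w′+1≈w = solve 1 (λ w → w :- con (+ 1) :+ con (+ 1) := w) refl w
    term : Carrier → Carrier → ℤ → ℕ → Carrier
    term z w q b = binom (z + fromℕ b) p * binom (w - fromℕ b - 1#) (q ℤ.- + b)
    q-1<N : q ℤ.- ℤ.1ℤ ℤ.< + N
    q-1<N = ℤP.+-monoˡ-< ℤ.-1ℤ q<1+N
    first : term z w q 0 ≈ binom z p * binom w′ q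
    first = *-cong (binom-cong p (+-identityʳ z))
                   (trans (binom-cong (q ℤ.- + 0) (solve 1 (λ w → w :- con (+ 0) :- con (+ 1) := w :- con (+ 1)) refl w))
                          (binom-index w′ (ℤP.+-identityʳ q)))
    rest : ∀ b → term z w q (suc b) ≈ term (z + 1#) w′ (q ℤ.- ℤ.1ℤ) b
    rest b = *-cong
      (binom-cong p (solve 2 (λ z b → z :+ (con (+ 1) :+ b) := z :+ con (+ 1) :+ b) refl z (fromℕ b)))
      (trans (binom-cong (q ℤ.- + suc b)
                (solve 2 (λ w b → w :- (con (+ 1) :+ b) :- con (+ 1) := w :- con (+ 1) :- b :- con (+ 1)) refl w (fromℕ b)))
             (binom-index _ (i-[1+j]≡i-1-j q (+ b))))

  sumFromTo-0-+ : ∀ n (f : ℤ → Carrier) → sumFromTo ℤ.0ℤ (+ n) f ≈ sumN (suc n) (λ i → f (+ i))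
  sumFromTo-0-+ n f = sumN-length _
    (≡.trans (ℕP.⊔-identityʳ _) (≡.trans (ℕP.+-comm _ 1) (≡.cong suc (ℕP.+-identityʳ n))))

  sumFromTo-0-negative : ∀ k (f : ℤ → Carrier) → sumFromTo ℤ.0ℤ -[1+ k ] f ≈ 0#
  sumFromTo-0-negative zero    f = refl
  sumFromTo-0-negative (suc k) f = refl

  doubleSumTerm : Carrier → Carrier → ℤ → ℤ → ℤ → ℤ → Carrier
  doubleSumTerm x y p q a b =
    binom (x - fromℤ a + fromℤ b - 1#) (p ℤ.- a) * binom (y + fromℤ a - fromℤ b - 1#) (q ℤ.- b)

  doubleSum : Carrier → Carrier → ℤ → ℤ → Carrier
  doubleSum x y p q = sumFromTo ℤ.0ℤ p (λ a → sumFromTo ℤ.0ℤ q (doubleSumTerm x y p q a))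

  doubleSum-weightedℕ : ∀ x y P Q M → P ℕ.< M → Q ℕ.< M →
    doubleSum x y (+ P) (+ Q) ≈ sumN M (λ j → fromℕ (suc j) * (binom x (+ P ℤ.- + j) * binom y (+ Q ℤ.- + j)))
  doubleSum-weightedℕ x y P Q M P<M Q<M = begin
    doubleSum x y (+ P) (+ Q)
      ≈⟨ trans (sumFromTo-0-+ P (λ a → sumFromTo ℤ.0ℤ (+ Q) (doubleSumTerm x y (+ P) (+ Q) a)))
               (sumN-cong (suc P) (λ a → sumFromTo-0-+ Q (doubleSumTerm x y (+ P) (+ Q) (+ a)))) ⟩
    sumN (suc P) (λ a → sumN (suc Q) (λ b →
      binom (x - fromℕ a + fromℕ b - 1#) (+ P ℤ.- + a) * binom (y + fromℕ a - fromℕ b - 1#) (+ Q ℤ.- + b)))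
      ≈⟨ sumN-cong (suc P) (λ a → trans (sumN-cong (suc Q) (λ b → *-congʳ (binom-cong (+ P ℤ.- + a)
             (solve 3 (λ x a b → x :- a :+ b :- con (+ 1) := x :- a :- con (+ 1) :+ b) refl x (fromℕ a) (fromℕ b)))))
           (binom-convolution (suc Q) (x - fromℕ a - 1#) (y + fromℕ a) (+ P ℤ.- + a) (+ Q) (ℤ.+<+ (ℕP.n<1+n Q)))) ⟩
    sumN (suc P) (λ a → diagonalSum (suc Q) (x - fromℕ a - 1#) (y + fromℕ a) (+ P ℤ.- + a) (+ Q))
      ≈⟨ sumN-swap (suc P) (suc Q) _ ⟩
    sumN (suc Q) (λ k → sumN (suc P) (λ a →
      binom (x - fromℕ a - 1#) ((+ P ℤ.- + a) ℤ.- + k) * binom (y + fromℕ a) (+ Q ℤ.- + k)))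
      ≈⟨ sumN-cong (suc Q) (λ k → trans (sumN-cong (suc P) (λ a → trans (*-comm _ _)
             (*-congˡ (binom-index _ (swap-indices (+ P) (+ a) (+ k))))))
           (binom-convolution (suc P) y x (+ Q ℤ.- + k) (+ P ℤ.- + k) (ℤP.≤-<-trans (ℤP.i-j≤i (+ P) (+ k)) (ℤ.+<+ (ℕP.n<1+n P))))) ⟩
    sumN (suc Q) (λ k → diagonalSum (suc P) y x (+ Q ℤ.- + k) (+ P ℤ.- + k))
      ≈⟨ sumN-cong (suc Q) (λ k → sumN-cong (suc P) (λ l → trans (*-comm _ _)
             (*-cong (binom-index x (merge-indices (+ P) (+ k) (+ l))) (binom-index y (merge-indices (+ Q) (+ k) (+ l)))))) ⟩
    sumN (suc Q) (λ k → sumN (suc P) (λ l → g (k ℕ.+ l)))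
      ≈⟨ sumN-rectangle (suc Q) (suc P) M g Q<M P<M g≈0ᑫ g≈0ᴾ ⟩
    sumN M (λ j → fromℕ (suc j) * g j) ∎
    where
    g : ℕ → Carrier
    g j = binom x (+ P ℤ.- + j) * binom y (+ Q ℤ.- + j)
    swap-indices : ∀ p a k → (p ℤ.- a) ℤ.- k ≡ (p ℤ.- k) ℤ.- a
    swap-indices = ℤ-Solver.solve-∀
    merge-indices : ∀ p k l → (p ℤ.- k) ℤ.- l ≡ p ℤ.- (k ℤ.+ l)
    merge-indices = ℤ-Solver.solve-∀
    g≈0ᴾ : ∀ j → P ℕ.< j → g j ≈ 0#
    g≈0ᴾ j P<j = trans (*-congʳ (binom-negative x (i<j⇒i-j<0 (ℤ.+<+ P<j)))) (zeroˡ _)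
    g≈0ᑫ : ∀ j → Q ℕ.< j → g j ≈ 0#
    g≈0ᑫ j Q<j = trans (*-congˡ (binom-negative y (i<j⇒i-j<0 (ℤ.+<+ Q<j)))) (zeroʳ _)

  doubleSum-weighted : ∀ x y p q M → p ℤ.< + M → q ℤ.< + M →
    doubleSum x y p q ≈ sumN M (λ j → fromℕ (suc j) * (binom x (p ℤ.- + j) * binom y (q ℤ.- + j)))
  doubleSum-weighted x y (+ P) (+ Q) M (ℤ.+<+ P<M) (ℤ.+<+ Q<M) = doubleSum-weightedℕ x y P Q M P<M Q<M
  doubleSum-weighted x y p@(-[1+ k ]) q M _ _ =
    trans (sumFromTo-0-negative k (λ a → sumFromTo ℤ.0ℤ q (doubleSumTerm x y p q a)))
          (sym (sumN-zero M _ (λ j _ → trans (*-congˡ (trans (*-congʳ (binom-negative x (-[1+k]-j<0 k j))) (zeroˡ _)))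
                                             (zeroʳ _))))
  doubleSum-weighted x y p@(+ P) q@(-[1+ k ]) M _ _ =
    trans (trans (sumFromTo-0-+ P (λ a → sumFromTo ℤ.0ℤ q (doubleSumTerm x y p q a)))
                 (sumN-zero (suc P) _ (λ a _ → sumFromTo-0-negative k (doubleSumTerm x y p q (+ a)))))
          (sym (sumN-zero M _ (λ j _ → trans (*-congˡ (trans (*-congˡ (binom-negative y (-[1+k]-j<0 k j))) (zeroʳ _)))
                                             (zeroʳ _))))

  binom-absorption-step : ∀ x m j →
    (x - fromℕ m + fromℕ (suc j)) * binom x (+ m ℤ.- + suc j) ≈ (fromℕ m - fromℕ j) * binom x (+ m ℤ.- + j)
  binom-absorption-step x m j = sym (begin
    (fromℕ m - fromℕ j) * binom x k
      ≈⟨ *-congʳ (sym (fromℤ-minus m j)) ⟩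
    fromℤ k * binom x k
      ≈⟨ binom-absorption x k ⟩
    (x - fromℤ k + 1#) * binom x (k ℤ.- ℤ.1ℤ)
      ≈⟨ *-cong (+-congʳ (+-congˡ (-‿cong (fromℤ-minus m j)))) (binom-index x k-1≡m-[1+j]) ⟩
    (x - (fromℕ m - fromℕ j) + 1#) * binom x (+ m ℤ.- + suc j)
      ≈⟨ *-congʳ (solve 3 (λ x m j → x :- (m :- j) :+ con (+ 1) := x :- m :+ (con (+ 1) :+ j)) refl x (fromℕ m) (fromℕ j)) ⟩
    (x - fromℕ m + fromℕ (suc j)) * binom x (+ m ℤ.- + suc j) ∎)
    where
    k : ℤ
    k = + m ℤ.- + j
    k-1≡m-[1+j] : k ℤ.- ℤ.1ℤ ≡ + m ℤ.- + suc j
    k-1≡m-[1+j] = ≡.trans (i-j-1≡i-1-j (+ m) (+ j)) (≡.sym (i-[1+j]≡i-1-j (+ m) (+ j)))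

  moment-identity : ∀ x y m n J → (x - fromℕ m) * (y - fromℕ n) ≈ fromℕ m * fromℕ n → m ℕ.< J →
    (x + y) * sumN J (λ j → fromℕ j * (binom x (+ m ℤ.- + j) * binom y (+ n ℤ.- + j)))
    ≈ fromℕ m * fromℕ n * (binom x (+ m) * binom y (+ n))
  moment-identity x y m n J hyp m<J = begin
    (x + y) * sumN J (λ j → fromℕ j * u j)    ≈⟨ *-distribˡ-sumN J _ _ ⟩
    sumN J (λ j → (x + y) * (fromℕ j * u j))  ≈⟨ sumN-cong J (λ j → sym (a-difference j)) ⟩
    sumN J (λ j → a j - a (suc j))             ≈⟨ sumN-telescope J a ⟩
    a 0 - a J                                  ≈⟨ +-cong a0 (-‿cong aJ) ⟩
    fromℕ m * fromℕ n * u 0 - 0#               ≈⟨ trans (+-congˡ -0#≈0#) (+-identityʳ _) ⟩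
    fromℕ m * fromℕ n * u 0                    ≈⟨ *-congˡ (*-cong (binom-index x (ℤP.+-identityʳ (+ m)))
                                                                  (binom-index y (ℤP.+-identityʳ (+ n)))) ⟩
    fromℕ m * fromℕ n * (binom x (+ m) * binom y (+ n)) ∎
    where
    u : ℕ → Carrier
    u j = binom x (+ m ℤ.- + j) * binom y (+ n ℤ.- + j)
    a : ℕ → Carrier
    a j = (x - fromℕ m + fromℕ j) * (y - fromℕ n + fromℕ j) * u j
    a0 : a 0 ≈ fromℕ m * fromℕ n * u 0
    a0 = *-congʳ (trans (*-cong (+-identityʳ _) (+-identityʳ _)) hyp)
    aJ : a J ≈ 0#
    aJ = trans (*-congˡ (trans (*-congʳ (binom-negative x (i<j⇒i-j<0 (ℤ.+<+ m<J)))) (zeroˡ _))) (zeroʳ _)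
    a-suc : ∀ j → a (suc j) ≈ (fromℕ m - fromℕ j) * (fromℕ n - fromℕ j) * u j
    a-suc j = begin
      (X′ * Y′) * (binom x (+ m ℤ.- + suc j) * binom y (+ n ℤ.- + suc j))
        ≈⟨ solve 4 (λ p q r s → (p :* q) :* (r :* s) := (p :* r) :* (q :* s)) refl X′ Y′ _ _ ⟩
      (X′ * binom x (+ m ℤ.- + suc j)) * (Y′ * binom y (+ n ℤ.- + suc j))
        ≈⟨ *-cong (binom-absorption-step x m j) (binom-absorption-step y n j) ⟩
      ((fromℕ m - fromℕ j) * binom x (+ m ℤ.- + j)) * ((fromℕ n - fromℕ j) * binom y (+ n ℤ.- + j))
        ≈⟨ solve 4 (λ p q r s → (p :* r) :* (q :* s) := (p :* q) :* (r :* s)) refl _ _ _ _ ⟩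
      (fromℕ m - fromℕ j) * (fromℕ n - fromℕ j) * u j ∎
      where
      X′ Y′ : Carrier
      X′ = x - fromℕ m + fromℕ (suc j)
      Y′ = y - fromℕ n + fromℕ (suc j)
    a-difference : ∀ j → a j - a (suc j) ≈ (x + y) * (fromℕ j * u j)
    a-difference j = begin
      a j - a (suc j)
        ≈⟨ +-congˡ (-‿cong (a-suc j)) ⟩
      (x - M + J′) * (y - N + J′) * u j - (M - J′) * (N - J′) * u j
        ≈⟨ solve 6 (λ x y M N J u → (x :- M :+ J) :* (y :- N :+ J) :* u :- (M :- J) :* (N :- J) :* u
                                 := ((x :- M) :* (y :- N) :- M :* N) :* u :+ (x :+ y) :* (J :* u)) refl x y M N J′ (u j) ⟩
      ((x - M) * (y - N) - M * N) * u j + (x + y) * (J′ * u j)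
        ≈⟨ +-congʳ (*-congʳ (+-congʳ hyp)) ⟩
      (M * N - M * N) * u j + (x + y) * (J′ * u j)
        ≈⟨ solve 3 (λ p u s → (p :- p) :* u :+ s := s) refl (M * N) (u j) _ ⟩
      (x + y) * (J′ * u j) ∎
      where
      M N J′ : Carrier
      M = fromℕ m
      N = fromℕ n
      J′ = fromℕ j

  sumFromTo-symmetric : ∀ r (f : ℤ → Carrier) →
    sumFromTo (ℤ.- + r) (+ r) f ≈ sumN (suc (r ℕ.+ r)) (λ i → f (ℤ.- + r ℤ.+ + i))
  sumFromTo-symmetric r f = sumN-length _
    (≡.trans (≡.cong (λ w → ∣ w ℤ.⊔ ℤ.0ℤ ∣) (width (+ r))) (ℕP.⊔-identityʳ (suc (r ℕ.+ r))))
    where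
    width : ∀ r → r ℤ.- ℤ.- r ℤ.+ ℤ.1ℤ ≡ ℤ.1ℤ ℤ.+ (r ℤ.+ r)
    width = ℤ-Solver.solve-∀

  module _ (x y : Carrier) (m n r : ℕ) where

    -- e i vanishes for i > min m n + r.  L = (2r + 2) + (m + n) = r + (r + 2 + m + n)
    -- suits both shifts of the index used below (by 2r + 2 and by r).
    L : ℕ
    L = suc (suc (r ℕ.+ r)) ℕ.+ (m ℕ.+ n)

    e : ℕ → Carrier
    e i = binom x (+ m ℤ.- (+ i ℤ.- + r)) * binom y (+ n ℤ.- (+ i ℤ.- + r))

    weighted : (ℕ → ℕ) → Carrier
    weighted c = sumN L (λ i → fromℕ (c i) * e i)

    weighted-+ : ∀ c d → weighted (λ i → c i ℕ.+ d i) ≈ weighted c + weighted d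
    weighted-+ c d = trans (sumN-cong L (λ i → trans (*-congʳ (fromℕ-+ (c i) (d i))) (distribʳ _ _ _)))
                           (sumN-+ L _ _)

    weighted-dropˡ : ∀ s M c → s ℕ.+ M ≡ L → (∀ i → i ℕ.< s → c i ≡ 0) →
                     weighted c ≈ sumN M (λ j → fromℕ (c (s ℕ.+ j)) * e (s ℕ.+ j))
    weighted-dropˡ s M c s+M≡L c≡0 = trans (sumN-length _ (≡.sym s+M≡L))
      (sumN-dropˡ s M _ (λ i i<s → trans (*-congʳ (reflexive (≡.cong fromℕ (c≡0 i i<s)))) (zeroˡ _)))

    upper-weighted : doubleSum x y (+ m ℤ.+ + r) (+ n ℤ.+ + r) ≈ weighted suc
    upper-weighted = trans (doubleSum-weighted x y _ _ L (ℤ.+<+ m+r<L) (ℤ.+<+ n+r<L))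
      (sumN-cong L (λ j → *-congˡ (*-cong (binom-index x (reindex (+ m) (+ r) (+ j)))
                                          (binom-index y (reindex (+ n) (+ r) (+ j))))))
      where
      reindex : ∀ m r j → m ℤ.+ r ℤ.- j ≡ m ℤ.- (j ℤ.- r)
      reindex = ℤ-Solver.solve-∀
      split : ∀ m n r → suc (m ℕ.+ r) ℕ.+ suc (r ℕ.+ n) ≡ suc (suc (r ℕ.+ r)) ℕ.+ (m ℕ.+ n)
      split = ℕ-Solver.solve-∀
      m+r<L : m ℕ.+ r ℕ.< L
      m+r<L = ℕP.m+n≤o⇒m≤o (suc (m ℕ.+ r)) (ℕP.≤-reflexive (split m n r))
      n+r<L : n ℕ.+ r ℕ.< L
      n+r<L = ℕP.m+n≤o⇒m≤o (suc (n ℕ.+ r))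
        (ℕP.≤-reflexive (≡.trans (split n m r) (≡.cong (suc (suc (r ℕ.+ r)) ℕ.+_) (ℕP.+-comm n m))))

    lower-weighted : doubleSum x y (+ m ℤ.- + r ℤ.- + 2) (+ n ℤ.- + r ℤ.- + 2) ≈ weighted (λ i → i ℕ.∸ suc (r ℕ.+ r))
    lower-weighted = begin
      doubleSum x y (+ m ℤ.- + r ℤ.- + 2) (+ n ℤ.- + r ℤ.- + 2)
        ≈⟨ doubleSum-weighted x y _ _ (m ℕ.+ n) (bound m (ℕP.m≤m+n m n)) (bound n (ℕP.m≤n+m n m)) ⟩
      sumN (m ℕ.+ n) (λ j → fromℕ (suc j) * (binom x (+ m ℤ.- + r ℤ.- + 2 ℤ.- + j) * binom y (+ n ℤ.- + r ℤ.- + 2 ℤ.- + j)))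
        ≈⟨ sumN-cong (m ℕ.+ n) (λ j → *-cong (reflexive (≡.cong fromℕ (≡.sym (weight j))))
             (*-cong (binom-index x (reindex (+ m) (+ r) (+ j))) (binom-index y (reindex (+ n) (+ r) (+ j))))) ⟩
      sumN (m ℕ.+ n) (λ j → fromℕ ((s ℕ.+ j) ℕ.∸ suc (r ℕ.+ r)) * e (s ℕ.+ j))
        ≈⟨ sym (weighted-dropˡ s (m ℕ.+ n) _ ≡.refl (λ i i<s → ℕP.m≤n⇒m∸n≡0 (ℕP.≤-pred i<s))) ⟩
      weighted (λ i → i ℕ.∸ suc (r ℕ.+ r)) ∎
      where
      s : ℕ
      s = suc (suc (r ℕ.+ r))
      reindex : ∀ m r j → m ℤ.- r ℤ.- + 2 ℤ.- j ≡ m ℤ.- ((+ 2 ℤ.+ r ℤ.+ r ℤ.+ j) ℤ.- r)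
      reindex = ℤ-Solver.solve-∀
      weight : ∀ j → (s ℕ.+ j) ℕ.∸ suc (r ℕ.+ r) ≡ suc j
      weight j = ≡.trans (≡.cong (ℕ._∸ suc (r ℕ.+ r)) (≡.sym (ℕP.+-suc (suc (r ℕ.+ r)) j)))
                         (ℕP.m+n∸m≡n (suc (r ℕ.+ r)) (suc j))
      bound : ∀ a → a ℕ.≤ m ℕ.+ n → + a ℤ.- + r ℤ.- + 2 ℤ.< + (m ℕ.+ n)
      bound a a≤m+n = ≡.subst (+ a ℤ.- + r ℤ.- + 2 ℤ.<_) (ℤP.+-identityʳ (+ (m ℕ.+ n)))
        (ℤP.+-mono-≤-< (ℤP.≤-trans (ℤP.i-j≤i (+ a) (+ r)) (ℤ.+≤+ a≤m+n)) (ℤ.-<+ {n = 0}))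

    middle-weighted :
      sumFromTo (ℤ.- + r) (+ r) (λ k → fromℤ (+ r ℤ.- + ∣ k ∣ ℤ.+ ℤ.1ℤ) * binom x (+ m ℤ.- k) * binom y (+ n ℤ.- k))
      ≈ weighted (λ i → suc r ℕ.∸ ℕ.∣ i - r ∣)
    middle-weighted = begin
      sumFromTo (ℤ.- + r) (+ r) f
        ≈⟨ sumFromTo-symmetric r f ⟩
      sumN (suc (r ℕ.+ r)) (λ i → f (ℤ.- + r ℤ.+ + i))
        ≈⟨ sumN-cong< (suc (r ℕ.+ r)) term ⟩
      sumN (suc (r ℕ.+ r)) (λ i → fromℕ (suc r ℕ.∸ ℕ.∣ i - r ∣) * e i)
        ≈⟨ sym (sumN-extend _ (ℕP.≤-trans (ℕP.n≤1+n _) (ℕP.m≤m+n _ (m ℕ.+ n))) (λ i 1+2r≤i _ →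
              trans (*-congʳ (reflexive (≡.cong fromℕ ([1+r]∸∣i-r∣≡0 r i 1+2r≤i)))) (zeroˡ _))) ⟩
      weighted (λ i → suc r ℕ.∸ ℕ.∣ i - r ∣) ∎
      where
      f : ℤ → Carrier
      f k = fromℤ (+ r ℤ.- + ∣ k ∣ ℤ.+ ℤ.1ℤ) * binom x (+ m ℤ.- k) * binom y (+ n ℤ.- k)
      -r+i≡i-r : ∀ r i → ℤ.- r ℤ.+ i ≡ i ℤ.- r
      -r+i≡i-r = ℤ-Solver.solve-∀
      term : ∀ i → i ℕ.< suc (r ℕ.+ r) → f (ℤ.- + r ℤ.+ + i) ≈ fromℕ (suc r ℕ.∸ ℕ.∣ i - r ∣) * e i
      term i i<1+2r = trans (*-assoc _ _ _) (*-cong weight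
        (*-cong (binom-index x (≡.cong (λ k → + m ℤ.- k) (-r+i≡i-r (+ r) (+ i))))
                (binom-index y (≡.cong (λ k → + n ℤ.- k) (-r+i≡i-r (+ r) (+ i))))))
        where
        ∣k∣≡∣i-r∣ : ∣ ℤ.- + r ℤ.+ + i ∣ ≡ ℕ.∣ i - r ∣
        ∣k∣≡∣i-r∣ = ≡.trans (≡.cong ∣_∣ (ℤP.-m+n≡n⊖m r i)) (∣m⊖n∣≡∣m-n∣ i r)
        weight : fromℤ (+ r ℤ.- + ∣ ℤ.- + r ℤ.+ + i ∣ ℤ.+ ℤ.1ℤ) ≈ fromℕ (suc r ℕ.∸ ℕ.∣ i - r ∣)
        weight = reflexive (≡.cong fromℤ (≡.trans (≡.cong (λ d → + r ℤ.- + d ℤ.+ ℤ.1ℤ) ∣k∣≡∣i-r∣)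
          (r-d+1≡[1+r]∸d r _ (ℕP.m≤n⇒m≤1+n (∣m-n∣≤n (ℕP.≤-pred i<1+2r))))))

    peak-weighted : ∀ D (D≉0 : ¬ (D ≈ 0#)) → D ≈ x + y → (x - fromℕ m) * (y - fromℕ n) ≈ fromℕ m * fromℕ n →
      fromℕ (2 ℕ.* m ℕ.* n) * inv D D≉0 * binom x (+ m) * binom y (+ n) ≈ weighted (λ i → 2 ℕ.* (i ℕ.∸ r))
    peak-weighted D D≉0 D≈x+y hyp = begin
      fromℕ (2 ℕ.* m ℕ.* n) * D⁻¹ * binom x (+ m) * binom y (+ n)
        ≈⟨ *-congʳ (*-congʳ (*-congʳ (trans (fromℕ-* (2 ℕ.* m) n) (*-congʳ (fromℕ-* 2 m))))) ⟩
      fromℕ 2 * fromℕ m * fromℕ n * D⁻¹ * binom x (+ m) * binom y (+ n)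
        ≈⟨ solve 6 (λ a b c d e f → a :* b :* c :* d :* e :* f := a :* (d :* (b :* c :* (e :* f)))) refl
                 (fromℕ 2) (fromℕ m) (fromℕ n) D⁻¹ (binom x (+ m)) (binom y (+ n)) ⟩
      fromℕ 2 * (D⁻¹ * (fromℕ m * fromℕ n * (binom x (+ m) * binom y (+ n))))
        ≈⟨ *-congˡ (*-congˡ (sym (moment-identity x y m n J hyp m<J))) ⟩
      fromℕ 2 * (D⁻¹ * ((x + y) * moment))
        ≈⟨ *-congˡ (trans (*-congˡ (*-congʳ (sym D≈x+y))) cancel) ⟩
      fromℕ 2 * moment
        ≈⟨ *-distribˡ-sumN J _ _ ⟩
      sumN J (λ j → fromℕ 2 * (fromℕ j * u j))
        ≈⟨ sumN-cong J (λ j → trans (sym (*-assoc _ _ _))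
             (*-cong (trans (sym (fromℕ-* 2 j)) (reflexive (≡.cong (λ t → fromℕ (2 ℕ.* t)) (≡.sym (ℕP.m+n∸m≡n r j)))))
                     (*-cong (binom-index x (≡.cong (λ k → + m ℤ.- k) (≡.sym (r+j-r≡j (+ r) (+ j)))))
                             (binom-index y (≡.cong (λ k → + n ℤ.- k) (≡.sym (r+j-r≡j (+ r) (+ j)))))))) ⟩
      sumN J (λ j → fromℕ (2 ℕ.* ((r ℕ.+ j) ℕ.∸ r)) * e (r ℕ.+ j))
        ≈⟨ sym (weighted-dropˡ r J _ (L-split m n r) (λ i i<r → ≡.cong (2 ℕ.*_) (ℕP.m≤n⇒m∸n≡0 (ℕP.<⇒≤ i<r)))) ⟩
      weighted (λ i → 2 ℕ.* (i ℕ.∸ r)) ∎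
      where
      D⁻¹ moment : Carrier
      D⁻¹ = inv D D≉0
      J : ℕ
      J = suc (suc r) ℕ.+ (m ℕ.+ n)
      u : ℕ → Carrier
      u j = binom x (+ m ℤ.- + j) * binom y (+ n ℤ.- + j)
      moment = sumN J (λ j → fromℕ j * u j)
      cancel : D⁻¹ * (D * moment) ≈ moment
      cancel = trans (sym (*-assoc _ _ _)) (trans (*-congʳ (trans (*-comm _ _) (inv-law D D≉0))) (*-identityˡ _))
      m<J : m ℕ.< J
      m<J = ℕ.s≤s (ℕP.≤-trans (ℕP.m≤m+n m n) (ℕP.≤-trans (ℕP.m≤n+m (m ℕ.+ n) r) (ℕP.n≤1+n _)))
      r+j-r≡j : ∀ r j → r ℤ.+ j ℤ.- r ≡ j
      r+j-r≡j = ℤ-Solver.solve-∀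
      L-split : ∀ m n r → r ℕ.+ (suc (suc r) ℕ.+ (m ℕ.+ n)) ≡ suc (suc (r ℕ.+ r)) ℕ.+ (m ℕ.+ n)
      L-split = ℕ-Solver.solve-∀

    main-identity : ∀ D (D≉0 : ¬ (D ≈ 0#)) → D ≈ x + y → (x - fromℕ m) * (y - fromℕ n) ≈ fromℕ m * fromℕ n →
      doubleSum x y (+ m ℤ.- + r ℤ.- + 2) (+ n ℤ.- + r ℤ.- + 2) + doubleSum x y (+ m ℤ.+ + r) (+ n ℤ.+ + r)
      ≈ fromℕ (2 ℕ.* m ℕ.* n) * inv D D≉0 * binom x (+ m) * binom y (+ n)
        + sumFromTo (ℤ.- + r) (+ r) (λ k → fromℤ (+ r ℤ.- + ∣ k ∣ ℤ.+ ℤ.1ℤ) * binom x (+ m ℤ.- k) * binom y (+ n ℤ.- k))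
    main-identity D D≉0 D≈x+y hyp = begin
      doubleSum x y (+ m ℤ.- + r ℤ.- + 2) (+ n ℤ.- + r ℤ.- + 2) + doubleSum x y (+ m ℤ.+ + r) (+ n ℤ.+ + r)
        ≈⟨ +-cong lower-weighted upper-weighted ⟩
      weighted (λ i → i ℕ.∸ suc (r ℕ.+ r)) + weighted suc
        ≈⟨ sym (weighted-+ (λ i → i ℕ.∸ suc (r ℕ.+ r)) suc) ⟩
      weighted (λ i → i ℕ.∸ suc (r ℕ.+ r) ℕ.+ suc i)
        ≈⟨ sumN-cong L (λ i → *-congʳ (reflexive (≡.cong fromℕ (weight-identity r i)))) ⟩
      weighted (λ i → 2 ℕ.* (i ℕ.∸ r) ℕ.+ (suc r ℕ.∸ ℕ.∣ i - r ∣))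
        ≈⟨ weighted-+ (λ i → 2 ℕ.* (i ℕ.∸ r)) (λ i → suc r ℕ.∸ ℕ.∣ i - r ∣) ⟩
      weighted (λ i → 2 ℕ.* (i ℕ.∸ r)) + weighted (λ i → suc r ℕ.∸ ℕ.∣ i - r ∣)
        ≈⟨ sym (+-cong (peak-weighted D D≉0 D≈x+y hyp) middle-weighted) ⟩
      fromℕ (2 ℕ.* m ℕ.* n) * inv D D≉0 * binom x (+ m) * binom y (+ n)
        + sumFromTo (ℤ.- + r) (+ r) (λ k → fromℤ (+ r ℤ.- + ∣ k ∣ ℤ.+ ℤ.1ℤ) * binom x (+ m ℤ.- k) * binom y (+ n ℤ.- k)) ∎

  denominator-split : ∀ α (α≉0 : ¬ (α ≈ 0#)) M N →
    (1# + α) * (M + inv α α≉0 * N) ≈ (1# + α) * M + (1# + inv α α≉0) * N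
  denominator-split α α≉0 M N = begin
    (1# + α) * (M + α⁻¹ * N)
      ≈⟨ solve 4 (λ a b M N → (con (+ 1) :+ a) :* (M :+ b :* N)
                           := (con (+ 1) :+ a) :* M :+ (con (+ 1) :+ b) :* N :+ (a :* b :- con (+ 1)) :* N) refl α α⁻¹ M N ⟩
    (1# + α) * M + (1# + α⁻¹) * N + (α * α⁻¹ - 1#) * N
      ≈⟨ +-congˡ (trans (*-congʳ (trans (+-congʳ (inv-law α α≉0)) (-‿inverseʳ 1#))) (zeroˡ N)) ⟩
    (1# + α) * M + (1# + α⁻¹) * N + 0#
      ≈⟨ +-identityʳ _ ⟩
    (1# + α) * M + (1# + α⁻¹) * N ∎
    where
    α⁻¹ : Carrier
    α⁻¹ = inv α α≉0

  shifted-product : ∀ α (α≉0 : ¬ (α ≈ 0#)) M N → ((1# + α) * M - M) * ((1# + inv α α≉0) * N - N) ≈ M * N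
  shifted-product α α≉0 M N = begin
    ((1# + α) * M - M) * ((1# + α⁻¹) * N - N)
      ≈⟨ solve 4 (λ a b M N → ((con (+ 1) :+ a) :* M :- M) :* ((con (+ 1) :+ b) :* N :- N) := (a :* b) :* (M :* N))
                refl α α⁻¹ M N ⟩
    (α * α⁻¹) * (M * N) ≈⟨ *-congʳ (inv-law α α≉0) ⟩
    1# * (M * N)        ≈⟨ *-identityˡ _ ⟩
    M * N               ∎
    where
    α⁻¹ : Carrier
    α⁻¹ = inv α α≉0

theorem2 : {c ℓ : Level} (F : CharZeroField c ℓ) →
  let open CharZeroField F
      open FieldOps F
  in (m n r : ℕ) (α : Carrier) (α≉0 : ¬ (α ≈ 0#)) →
     let α⁻¹ = inv α α≉0
         M = fromℕ m
         N = fromℕ n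
         A = (1# + α) * M
         B = (1# + α⁻¹) * N
         D = (1# + α) * (M + α⁻¹ * N)
     in (D≉0 : ¬ (D ≈ 0#)) →
        (sumFromTo ℤ.0ℤ (+ m ℤ.- + r ℤ.- + 2) (λ a →
           sumFromTo ℤ.0ℤ (+ n ℤ.- + r ℤ.- + 2) (λ b →
             binom (A - fromℤ a + fromℤ b - 1#) (+ m ℤ.- + r ℤ.- + 2 ℤ.- a)
             * binom (B + fromℤ a - fromℤ b - 1#) (+ n ℤ.- + r ℤ.- + 2 ℤ.- b)))
        + sumFromTo ℤ.0ℤ (+ m ℤ.+ + r) (λ a →
           sumFromTo ℤ.0ℤ (+ n ℤ.+ + r) (λ b →
             binom (A - fromℤ a + fromℤ b - 1#) (+ m ℤ.+ + r ℤ.- a)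
             * binom (B + fromℤ a - fromℤ b - 1#) (+ n ℤ.+ + r ℤ.- b))))
        ≈
        (fromℕ (2 ℕ.* m ℕ.* n) * inv D D≉0 * binom A (+ m) * binom B (+ n)
        + sumFromTo (ℤ.- + r) (+ r) (λ k →
            fromℤ (+ r ℤ.- + ∣ k ∣ ℤ.+ ℤ.1ℤ)
            * binom A (+ m ℤ.- k) * binom B (+ n ℤ.- k)))
theorem2 F m n r α α≉0 D≉0 =
  main-identity F A B m n r D D≉0 (denominator-split F α α≉0 M N) (shifted-product F α α≉0 M N)
  where
  open CharZeroField F using (Carrier; _+_; _*_; 1#; inv; fromℕ)
  M N A B D : Carrier
  M = fromℕ m
  N = fromℕ n
  A = (1# + α) * M
  B = (1# + inv α α≉0) * N
  D = (1# + α) * (M + inv α α≉0 * N)
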